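{- Let $n \ge 3$. Any deterministic algorithm that, for every undirected graph on vertex set $[n]$ with non-negative real edge weights, outputs exactly the max cut value $\max_{S \subseteq [n]} F(S)$ using cut queries must make at least $\binom{n}{2}$ queries when $n$ is odd, and at least $\binom{n-1}{2}$ queries when $n$ is even. In particular, the deterministic query complexity of exactly computing the max cut value of a weighted undirected graph is $\Omega(n^2)$.
   Context: Cut query model: an undirected graph $G$ on vertex set $[n]$ has non-negative edge weights $w_{i,j}$, and its cut function is $F(S) = \sum_{i \in S, j \notin S} w_{i,j}$ for $S \subseteq [n]$. An algorithm has no access to $G$ except through queries: it submits a set $S \subseteq [n]$ and receives $F(S)$; queries may be adaptive, computation is unlimited, and the query complexity is the number of queries. -}

module Defs where

open import Data.Nat using (ℕ; zero; suc)
open import Data.Bool using (Bool; true; false)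
open import Data.Fin using (Fin)
import Data.Fin as Fin
open import Data.Vec using (Vec; []; _∷_)
open import Data.List using (List; []; _∷_; map; _++_; foldr)
open import Data.Fin.Subset using (Subset; _∈_; _∉_)
open import Data.Rational using (ℚ; 0ℚ; _+_; _⊔_; _≤_)
open import Relation.Nullary using (yes; no)
open import Data.Fin.Subset.Properties using (_∈?_)
open import Data.Product using (_×_)
open import Relation.Binary.PropositionalEquality using (_≡_)

-- Edge weights of a graph on vertex set [n] = Fin n, as a function on ordered
-- pairs.  A weighted undirected graph is a symmetric non-negative such function
-- (diagonal entries never contribute to any cut).
Weights : ℕ → Set
Weights n = Fin n → Fin n → ℚ

IsWeightedGraph : ∀ {n} → Weights n → Set
IsWeightedGraph {n} w = (∀ i j → w i j ≡ w j i) × (∀ i j → 0ℚ ≤ w i j)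

sumFin : ∀ n → (Fin n → ℚ) → ℚ
sumFin zero    f = 0ℚ
sumFin (suc n) f = f Fin.zero + sumFin n (λ i → f (Fin.suc i))

cutTerm : ∀ {n} → Weights n → Subset n → Fin n → Fin n → ℚ
cutTerm w S i j with i ∈? S
... | no _  = 0ℚ
... | yes _ with j ∈? S
...   | yes _ = 0ℚ
...   | no _  = w i j

cut : ∀ {n} → Weights n → Subset n → ℚ
cut {n} w S = sumFin n (λ i → sumFin n (λ j → cutTerm w S i j))

allSubsets : ∀ n → List (Subset n)
allSubsets zero    = [] ∷ []
allSubsets (suc n) = map (true ∷_) (allSubsets n) ++ map (false ∷_) (allSubsets n)

-- max_{S ⊆ [n]} F(S)  (all cut values are ≥ 0 and F(∅) = 0, so starting the
-- fold at 0 is harmless)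
maxCut : ∀ {n} → Weights n → ℚ
maxCut {n} w = foldr (λ S m → cut w S ⊔ m) 0ℚ (allSubsets n)

-- Deterministic adaptive cut-query algorithm, as a decision tree:
-- either stop with an output, or query a set S and continue depending on F(S).
data Alg (n : ℕ) : Set where
  done  : ℚ → Alg n
  query : Subset n → (ℚ → Alg n) → Alg n

output : ∀ {n} → Alg n → Weights n → ℚ
output (done v)    w = v
output (query S k) w = output (k (cut w S)) w

queries : ∀ {n} → Alg n → Weights n → ℕ
queries (done v)    w = 0
queries (query S k) w = suc (queries (k (cut w S)) w)

-- Let m = 2k + 1. The maximum cuts of the complete graph K_m are exactly its balanced cuts, with
-- sides of sizes k and k + 1. A symmetric weighting with zero diagonal is given by its C(m,2) edge
-- weights, and every cut value is a linear form in them. If A asks fewer than C(m,2) queries on K_m,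
-- some nonzero weighting d is orthogonal to all of them; then A cannot distinguish K_m from
-- K_m ± s d for small s > 0 and reports the same maximum, so d vanishes on every maximum cut of K_m.
-- Second differences of cuts show that this forces all edge weights of d to be equal, and then 0.
-- For even n, A is run on K_(n-1) with an isolated vertex added, which no cut query can detect.

module Submission where

open import Defs

open import Data.Bool using (true; false; if_then_else_)
open import Data.Empty using (⊥-elim)
open import Data.Fin using (Fin; zero; suc; _↑ˡ_; _↑ʳ_; splitAt)
import Data.Fin as Fin
open import Data.Fin.Subset using (Subset; _∈_; _∉_; inside; outside; ∣_∣; ∁) renaming (⊥ to ∅)
open import Data.List using (List; []; _∷_; length; map; foldr)
open import Data.List.Membership.Propositional using () renaming (_∈_ to _∈ₗ_)
open import Data.List.Membership.Propositional.Properties using (∈-map⁺; ∈-++⁺ˡ; ∈-++⁺ʳ)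
open import Data.List.Relation.Unary.Any using (here; there)
open import Data.List.Properties using (length-map)
open import Data.List.Relation.Binary.Permutation.Propositional using (_↭_; ↭-refl; ↭-trans; ↭-sym)
import Data.List.Relation.Binary.Permutation.Propositional as ↭
open import Data.List.Relation.Binary.Permutation.Propositional.Properties using (All-resp-↭; ↭-length)
open import Data.List.Relation.Unary.All using (All; []; _∷_)
import Data.List.Relation.Unary.All as All
import Data.List.Relation.Unary.All.Properties as All
import Data.Nat as ℕ
open ℕ using (ℕ)
import Data.Nat.Properties as ℕ
open import Data.Nat.Tactic.RingSolver using () renaming (solve-∀ to ℕ-solve)
open import Data.Nat.DivMod using (_%_; _/_; m≡m%n+[m/n]*n)
open import Data.Nat.Combinatorics using (_C_; nC1≡n; nCk+nC[k+1]≡[n+1]C[k+1])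
open import Data.Product using (_×_; _,_; ∃; proj₁; proj₂)
open import Data.Rational
  using (ℚ; 0ℚ; 1ℚ; _+_; _*_; -_; _-_; _≤_; _<_; _⊔_; 1/_; Positive; NonZero; NonNegative;
         positive; nonNegative; ≢-nonZero; ½)
  renaming (∣_∣ to abs)
open import Data.Rational.Properties
open import Data.Sum using (_⊎_; inj₁; inj₂; [_,_]′)
open import Data.Vec using ([]; _∷_; lookup; tail; _[_]≔_)
open import Data.Vec.Properties
  using ([]=⇒lookup; lookup⇒[]=; lookup∘updateAt; lookup∘updateAt′; lookup-replicate)
open import Data.Fin.Subset.Properties using (_∈?_; ∣p∣≤n; ∣∁p∣≡n∸∣p∣; ∣⊥∣≡0)
open import Data.Fin.Properties using (splitAt-↑ˡ; splitAt-↑ʳ; splitAt⁻¹-↑ˡ; splitAt⁻¹-↑ʳ)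
open import Level using (0ℓ)
open import Relation.Binary.PropositionalEquality
open import Relation.Nullary using (¬_; yes; no)
open import Relation.Nullary.Decidable using (dec⇒maybe)
open import Tactic.RingSolver using (solve-∀)
open import Tactic.RingSolver.Core.AlmostCommutativeRing using (AlmostCommutativeRing; fromCommutativeRing)

ℚ-ring : AlmostCommutativeRing 0ℓ 0ℓ
ℚ-ring = fromCommutativeRing +-*-commutativeRing (λ x → dec⇒maybe (0ℚ ≟ x))

p*q≡0⇒q≡0 : ∀ {p q} → p ≢ 0ℚ → p * q ≡ 0ℚ → q ≡ 0ℚ
p*q≡0⇒q≡0 {p} {q} p≢0 pq≡0 = begin
  q                ≡⟨ sym (*-identityˡ q) ⟩
  1ℚ * q           ≡⟨ cong (_* q) (sym (*-inverseˡ p)) ⟩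
  1/ p * p * q     ≡⟨ *-assoc (1/ p) p q ⟩
  1/ p * (p * q)   ≡⟨ cong (1/ p *_) pq≡0 ⟩
  1/ p * 0ℚ        ≡⟨ *-zeroʳ (1/ p) ⟩
  0ℚ               ∎
  where
  open ≡-Reasoning
  instance
    _ : NonZero p
    _ = ≢-nonZero p≢0

x+y≤x⇒y≤0 : ∀ {x y} → x + y ≤ x → y ≤ 0ℚ
x+y≤x⇒y≤0 {x} {y} x+y≤x = subst₂ _≤_ (cancel x y) (+-inverseʳ x) (+-monoˡ-≤ (- x) x+y≤x)
  where
  cancel : ∀ x y → x + y - x ≡ y
  cancel = solve-∀ ℚ-ring

sumFin-cong : ∀ n {f g : Fin n → ℚ} → (∀ i → f i ≡ g i) → sumFin n f ≡ sumFin n g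
sumFin-cong ℕ.zero    f≗g = refl
sumFin-cong (ℕ.suc n) f≗g = cong₂ _+_ (f≗g zero) (sumFin-cong n (λ i → f≗g (suc i)))

sumFin-zero : ∀ n → sumFin n (λ _ → 0ℚ) ≡ 0ℚ
sumFin-zero ℕ.zero    = refl
sumFin-zero (ℕ.suc n) = trans (+-identityˡ _) (sumFin-zero n)

sumFin-+ : ∀ n (f g : Fin n → ℚ) → sumFin n (λ i → f i + g i) ≡ sumFin n f + sumFin n g
sumFin-+ ℕ.zero    f g = sym (+-identityˡ 0ℚ)
sumFin-+ (ℕ.suc n) f g =
  trans (cong (f zero + g zero +_) (sumFin-+ n (λ i → f (suc i)) (λ i → g (suc i))))
        (interchange (f zero) (g zero) _ _)
  where
  interchange : ∀ a b c d → (a + b) + (c + d) ≡ (a + c) + (b + d)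
  interchange = solve-∀ ℚ-ring

sumFin-*ˡ : ∀ n c (f : Fin n → ℚ) → sumFin n (λ i → c * f i) ≡ c * sumFin n f
sumFin-*ˡ ℕ.zero    c f = sym (*-zeroʳ c)
sumFin-*ˡ (ℕ.suc n) c f = trans (cong (c * f zero +_) (sumFin-*ˡ n c _)) (sym (*-distribˡ-+ c _ _))

sumFin-linear : ∀ n (f g : Fin n → ℚ) t → sumFin n (λ i → f i + t * g i) ≡ sumFin n f + t * sumFin n g
sumFin-linear n f g t = trans (sumFin-+ n f (λ i → t * g i)) (cong (sumFin n f +_) (sumFin-*ˡ n t g))

sumFin-++ : ∀ m n (g : Fin (m ℕ.+ n) → ℚ) →
            sumFin (m ℕ.+ n) g ≡ sumFin m (λ i → g (i ↑ˡ n)) + sumFin n (λ i → g (m ↑ʳ i))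
sumFin-++ ℕ.zero    n g = sym (+-identityˡ _)
sumFin-++ (ℕ.suc m) n g =
  trans (cong (g zero +_) (sumFin-++ m n (λ i → g (suc i)))) (sym (+-assoc (g zero) _ _))

sumFin-nonNeg : ∀ n (f : Fin n → ℚ) → (∀ i → 0ℚ ≤ f i) → 0ℚ ≤ sumFin n f
sumFin-nonNeg ℕ.zero    f f≥0 = ≤-refl
sumFin-nonNeg (ℕ.suc n) f f≥0 =
  subst (_≤ sumFin (ℕ.suc n) f) (+-identityˡ 0ℚ)
        (+-mono-≤ (f≥0 zero) (sumFin-nonNeg n (λ i → f (suc i)) (λ i → f≥0 (suc i))))

term≤sumFin : ∀ n (f : Fin n → ℚ) → (∀ i → 0ℚ ≤ f i) → ∀ i → f i ≤ sumFin n f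
term≤sumFin (ℕ.suc n) f f≥0 zero =
  subst (_≤ sumFin (ℕ.suc n) f) (+-identityʳ (f zero))
        (+-monoʳ-≤ (f zero) (sumFin-nonNeg n (λ i → f (suc i)) (λ i → f≥0 (suc i))))
term≤sumFin (ℕ.suc n) f f≥0 (suc i) =
  ≤-trans (term≤sumFin n (λ i → f (suc i)) (λ i → f≥0 (suc i)) i)
          (subst (_≤ sumFin (ℕ.suc n) f) (+-identityˡ _) (+-monoˡ-≤ (sumFin n (λ i → f (suc i))) (f≥0 zero)))

δ : ∀ {n} → Fin n → Fin n → ℚ
δ zero    zero    = 1ℚ
δ zero    (suc _) = 0ℚ
δ (suc _) zero    = 0ℚ
δ (suc i) (suc j) = δ i j

sumFin-δ : ∀ n a (f : Fin n → ℚ) → sumFin n (λ i → δ a i * f i) ≡ f a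
sumFin-δ (ℕ.suc n) zero f = begin
  1ℚ * f zero + sumFin n (λ i → 0ℚ * f (suc i))  ≡⟨ cong₂ _+_ (*-identityˡ (f zero))
                                                         (trans (sumFin-cong n (λ i → *-zeroˡ (f (suc i)))) (sumFin-zero n)) ⟩
  f zero + 0ℚ                                      ≡⟨ +-identityʳ (f zero) ⟩
  f zero                                           ∎
  where open ≡-Reasoning
sumFin-δ (ℕ.suc n) (suc a) f =
  trans (cong₂ _+_ (*-zeroˡ (f zero)) (sumFin-δ n a (λ i → f (suc i)))) (+-identityˡ _)

fromℕ : ℕ → ℚ
fromℕ ℕ.zero    = 0ℚ
fromℕ (ℕ.suc n) = 1ℚ + fromℕ n

fromℕ-+ : ∀ a b → fromℕ (a ℕ.+ b) ≡ fromℕ a + fromℕ b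
fromℕ-+ ℕ.zero    b = sym (+-identityˡ _)
fromℕ-+ (ℕ.suc a) b = trans (cong (1ℚ +_) (fromℕ-+ a b)) (sym (+-assoc 1ℚ (fromℕ a) (fromℕ b)))

fromℕ-* : ∀ a b → fromℕ (a ℕ.* b) ≡ fromℕ a * fromℕ b
fromℕ-* ℕ.zero    b = sym (*-zeroˡ (fromℕ b))
fromℕ-* (ℕ.suc a) b = begin
  fromℕ (b ℕ.+ a ℕ.* b)      ≡⟨ fromℕ-+ b (a ℕ.* b) ⟩
  fromℕ b + fromℕ (a ℕ.* b)  ≡⟨ cong (fromℕ b +_) (fromℕ-* a b) ⟩
  fromℕ b + fromℕ a * fromℕ b ≡⟨ distrib (fromℕ a) (fromℕ b) ⟩
  (1ℚ + fromℕ a) * fromℕ b    ∎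
  where
  open ≡-Reasoning
  distrib : ∀ x y → y + x * y ≡ (1ℚ + x) * y
  distrib = solve-∀ ℚ-ring

0≤fromℕ : ∀ n → 0ℚ ≤ fromℕ n
0≤fromℕ ℕ.zero    = ≤-refl
0≤fromℕ (ℕ.suc n) = +-mono-≤ (nonNegative⁻¹ 1ℚ) (0≤fromℕ n)

0<fromℕ-suc : ∀ n → 0ℚ < fromℕ (ℕ.suc n)
0<fromℕ-suc n = +-mono-<-≤ (positive⁻¹ 1ℚ) (0≤fromℕ n)

fromℕ-mono-≤ : ∀ {a b} → a ℕ.≤ b → fromℕ a ≤ fromℕ b
fromℕ-mono-≤ {a} a≤b with ℕ.m≤n⇒∃[o]m+o≡n a≤b
... | c , refl = subst (_≤ fromℕ (a ℕ.+ c)) (+-identityʳ (fromℕ a))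
                   (subst (fromℕ a + 0ℚ ≤_) (sym (fromℕ-+ a c)) (+-monoʳ-≤ (fromℕ a) (0≤fromℕ c)))

-- Cuts as bilinear forms

χ : ∀ {n} → Subset n → Fin n → ℚ
χ S i = if lookup S i then 1ℚ else 0ℚ

sumFin-χ : ∀ {n} (S : Subset n) → sumFin n (χ S) ≡ fromℕ ∣ S ∣
sumFin-χ []          = refl
sumFin-χ (true  ∷ S) = cong (1ℚ +_) (sumFin-χ S)
sumFin-χ (false ∷ S) = trans (+-identityˡ _) (sumFin-χ S)

χ-∈ : ∀ {n} {S : Subset n} {i} → i ∈ S → χ S i ≡ 1ℚ
χ-∈ i∈S = cong (if_then 1ℚ else 0ℚ) ([]=⇒lookup i∈S)

χ-∉ : ∀ {n} {S : Subset n} {i} → i ∉ S → χ S i ≡ 0ℚ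
χ-∉ {S = S} {i} i∉S with lookup S i in eq
... | true  = ⊥-elim (i∉S (lookup⇒[]= i S eq))
... | false = refl

χ*[1-χ]≡0 : ∀ {n} (S : Subset n) i → χ S i * (1ℚ - χ S i) ≡ 0ℚ
χ*[1-χ]≡0 S i with lookup S i
... | true  = *-zeroʳ 1ℚ
... | false = *-zeroˡ 1ℚ

dot : ∀ {N} → (Fin N → ℚ) → (Fin N → ℚ) → ℚ
dot {N} a x = sumFin N (λ l → a l * x l)

inner : ∀ {n} → (Fin n → Fin n → ℚ) → Weights n → ℚ
inner {n} A d = sumFin n (λ i → dot (A i) (d i))

crossing : ∀ {n} → Subset n → Fin n → Fin n → ℚ
crossing S i j = χ S i * (1ℚ - χ S j)

cut≡inner : ∀ {n} (w : Weights n) S → cut w S ≡ inner (crossing S) w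
cut≡inner {n} w S = sumFin-cong n (λ i → sumFin-cong n (λ j → cutTerm≡ i j))
  where
  zero-left : ∀ a b → 0ℚ * a * b ≡ 0ℚ
  zero-left = solve-∀ ℚ-ring
  one-one : ∀ a → 1ℚ * (1ℚ - 1ℚ) * a ≡ 0ℚ
  one-one = solve-∀ ℚ-ring
  one-zero : ∀ a → 1ℚ * (1ℚ - 0ℚ) * a ≡ a
  one-zero = solve-∀ ℚ-ring
  cutTerm≡ : ∀ i j → cutTerm w S i j ≡ crossing S i j * w i j
  cutTerm≡ i j with i ∈? S
  ... | no i∉S =
    sym (trans (cong (λ x → x * (1ℚ - χ S j) * w i j) (χ-∉ i∉S)) (zero-left (1ℚ - χ S j) (w i j)))
  ... | yes i∈S with j ∈? S
  ...   | yes j∈S =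
    sym (trans (cong₂ (λ x y → x * (1ℚ - y) * w i j) (χ-∈ i∈S) (χ-∈ j∈S)) (one-one (w i j)))
  ...   | no j∉S  =
    sym (trans (cong₂ (λ x y → x * (1ℚ - y) * w i j) (χ-∈ i∈S) (χ-∉ j∉S)) (one-zero (w i j)))

inner-cong : ∀ {n} (A : Fin n → Fin n → ℚ) {d e : Weights n} →
             (∀ i j → d i j ≡ e i j) → inner A d ≡ inner A e
inner-cong {n} A d≗e = sumFin-cong n (λ i → sumFin-cong n (λ j → cong (A i j *_) (d≗e i j)))

inner-congˡ : ∀ {n} {A B : Fin n → Fin n → ℚ} (d : Weights n) →
              (∀ i j → A i j ≡ B i j) → inner A d ≡ inner B d
inner-congˡ {n} d A≗B = sumFin-cong n (λ i → sumFin-cong n (λ j → cong (_* d i j) (A≗B i j)))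

inner-+ˡ : ∀ {n} (A B : Fin n → Fin n → ℚ) d → inner (λ i j → A i j + B i j) d ≡ inner A d + inner B d
inner-+ˡ {n} A B d =
  trans (sumFin-cong n (λ i → trans (sumFin-cong n (λ j → *-distribʳ-+ (d i j) (A i j) (B i j)))
                                    (sumFin-+ n _ _)))
        (sumFin-+ n _ _)

inner-linear : ∀ {n} (A : Fin n → Fin n → ℚ) w d t →
               inner A (λ i j → w i j + t * d i j) ≡ inner A w + t * inner A d
inner-linear {n} A w d t =
  trans (sumFin-cong n (λ i → trans (sumFin-cong n (λ j → distrib (A i j) (w i j) t (d i j)))
                                    (sumFin-linear n _ _ t)))
        (sumFin-linear n _ _ t)
  where
  distrib : ∀ a x t y → a * (x + t * y) ≡ a * x + t * (a * y)
  distrib = solve-∀ ℚ-ring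

inner-*ʳ : ∀ {n} (A : Fin n → Fin n → ℚ) t d → inner A (λ i j → t * d i j) ≡ t * inner A d
inner-*ʳ {n} A t d =
  trans (sumFin-cong n (λ i → trans (sumFin-cong n (λ j → swap (A i j) t (d i j))) (sumFin-*ˡ n t _)))
        (sumFin-*ˡ n t _)
  where
  swap : ∀ a t x → a * (t * x) ≡ t * (a * x)
  swap = solve-∀ ℚ-ring

inner-δδ : ∀ {n} (a b : Fin n) d → inner (λ i j → δ a i * δ b j) d ≡ d a b
inner-δδ {n} a b d =
  trans (sumFin-cong n (λ i → trans (sumFin-cong n (λ j → *-assoc (δ a i) (δ b j) (d i j)))
                                    (trans (sumFin-*ˡ n (δ a i) _) (cong (δ a i *_) (sumFin-δ n b (d i))))))
        (sumFin-δ n a (λ i → d i b))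

allSubsets-complete : ∀ n (S : Subset n) → S ∈ₗ allSubsets n
allSubsets-complete ℕ.zero    []          = here refl
allSubsets-complete (ℕ.suc n) (true  ∷ S) = ∈-++⁺ˡ (∈-map⁺ (true ∷_) (allSubsets-complete n S))
allSubsets-complete (ℕ.suc n) (false ∷ S) =
  ∈-++⁺ʳ (map (true ∷_) (allSubsets n)) (∈-map⁺ (false ∷_) (allSubsets-complete n S))

module _ {n} (w : Weights n) where

  private
    maxOf : List (Subset n) → ℚ
    maxOf = foldr (λ S m → cut w S ⊔ m) 0ℚ

    cut≤maxOf : ∀ {L S} → S ∈ₗ L → cut w S ≤ maxOf L
    cut≤maxOf {S ∷ L} (here refl) = p≤p⊔q (cut w S) (maxOf L)
    cut≤maxOf {T ∷ L} (there S∈L) = ≤-trans (cut≤maxOf S∈L) (p≤q⊔p (cut w T) (maxOf L))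

    maxOf≤ : ∀ L {V} → (∀ S → cut w S ≤ V) → 0ℚ ≤ V → maxOf L ≤ V
    maxOf≤ []      cuts≤V 0≤V = 0≤V
    maxOf≤ (S ∷ L) cuts≤V 0≤V = ⊔-lub (cuts≤V S) (maxOf≤ L cuts≤V 0≤V)

    0≤maxOf : ∀ L → 0ℚ ≤ maxOf L
    0≤maxOf []      = ≤-refl
    0≤maxOf (S ∷ L) = ≤-trans (0≤maxOf L) (p≤q⊔p (cut w S) (maxOf L))

  cut≤maxCut : ∀ S → cut w S ≤ maxCut w
  cut≤maxCut S = cut≤maxOf (allSubsets-complete n S)

  maxCut≤ : ∀ {V} → (∀ S → cut w S ≤ V) → 0ℚ ≤ V → maxCut w ≤ V
  maxCut≤ = maxOf≤ (allSubsets n)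

  0≤maxCut : 0ℚ ≤ maxCut w
  0≤maxCut = 0≤maxOf (allSubsets n)

  maximum-cut : ∀ {V} S → cut w S ≡ V → (∀ T → cut w T ≤ V) → 0ℚ ≤ V → cut w S ≡ maxCut w
  maximum-cut S refl cuts≤V 0≤V = ≤-antisym (cut≤maxCut S) (maxCut≤ cuts≤V 0≤V)

queriedSets : ∀ {n} → Alg n → Weights n → List (Subset n)
queriedSets (done v)    w = []
queriedSets (query S k) w = S ∷ queriedSets (k (cut w S)) w

length-queriedSets : ∀ {n} (A : Alg n) w → length (queriedSets A w) ≡ queries A w
length-queriedSets (done v)    w = refl
length-queriedSets (query S k) w = cong ℕ.suc (length-queriedSets (k (cut w S)) w)

output-determined : ∀ {n} (A : Alg n) {w w′ : Weights n} →
                    All (λ S → cut w′ S ≡ cut w S) (queriedSets A w) → output A w′ ≡ output A w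
output-determined (done v)    []           = refl
output-determined (query S k) (same ∷ sames) rewrite same = output-determined (k _) sames

SolvesMaxCut : ∀ {n} → Alg n → Set
SolvesMaxCut {n} A = ∀ (w : Weights n) → IsWeightedGraph w → output A w ≡ maxCut w

addIsolatedVertex : ∀ {m} → Weights m → Weights (ℕ.suc m)
addIsolatedVertex w zero    j       = 0ℚ
addIsolatedVertex w (suc i) zero    = 0ℚ
addIsolatedVertex w (suc i) (suc j) = w i j

addIsolatedVertex-isWeightedGraph : ∀ {m} {w : Weights m} → IsWeightedGraph w → IsWeightedGraph (addIsolatedVertex w)
addIsolatedVertex-isWeightedGraph {w = w} (w-sym , w≥0) = sym′ , nonNeg
  where
  sym′ : ∀ i j → addIsolatedVertex w i j ≡ addIsolatedVertex w j i
  sym′ zero    zero    = refl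
  sym′ zero    (suc j) = refl
  sym′ (suc i) zero    = refl
  sym′ (suc i) (suc j) = w-sym i j
  nonNeg : ∀ i j → 0ℚ ≤ addIsolatedVertex w i j
  nonNeg zero    j       = ≤-refl
  nonNeg (suc i) zero    = ≤-refl
  nonNeg (suc i) (suc j) = w≥0 i j

cut-addIsolatedVertex : ∀ {m} (w : Weights m) b S → cut (addIsolatedVertex w) (b ∷ S) ≡ cut w S
cut-addIsolatedVertex {m} w b S = begin
  cut (addIsolatedVertex w) (b ∷ S)
    ≡⟨ cut≡inner (addIsolatedVertex w) (b ∷ S) ⟩
  dot (A zero) (λ _ → 0ℚ) + sumFin m (λ i → A (suc i) zero * 0ℚ + dot (crossing S i) (w i))
    ≡⟨ cong₂ _+_ (trans (sumFin-cong (ℕ.suc m) (λ j → *-zeroʳ (A zero j))) (sumFin-zero (ℕ.suc m)))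
                 (sumFin-cong m (λ i → trans (cong (_+ dot (crossing S i) (w i)) (*-zeroʳ (A (suc i) zero)))
                                             (+-identityˡ _))) ⟩
  0ℚ + inner (crossing S) w
    ≡⟨ +-identityˡ _ ⟩
  inner (crossing S) w
    ≡⟨ sym (cut≡inner w S) ⟩
  cut w S ∎
  where
  open ≡-Reasoning
  A = crossing (b ∷ S)

maxCut-addIsolatedVertex : ∀ {m} (w : Weights m) → maxCut (addIsolatedVertex w) ≡ maxCut w
maxCut-addIsolatedVertex w = ≤-antisym
  (maxCut≤ (addIsolatedVertex w)
    (λ { (b ∷ S) → subst (_≤ maxCut w) (sym (cut-addIsolatedVertex w b S)) (cut≤maxCut w S) })
    (0≤maxCut w))
  (maxCut≤ w
    (λ S → subst (_≤ maxCut (addIsolatedVertex w)) (cut-addIsolatedVertex w false S)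
                 (cut≤maxCut (addIsolatedVertex w) (false ∷ S)))
    (0≤maxCut (addIsolatedVertex w)))

withIsolatedVertex : ∀ {m} → Alg (ℕ.suc m) → Alg m
withIsolatedVertex (done v)    = done v
withIsolatedVertex (query S k) = query (tail S) (λ r → withIsolatedVertex (k r))

module _ {m} (w : Weights m) where

  output-withIsolatedVertex : ∀ A → output (withIsolatedVertex A) w ≡ output A (addIsolatedVertex w)
  output-withIsolatedVertex (done v)          = refl
  output-withIsolatedVertex (query (b ∷ S) k)
    rewrite cut-addIsolatedVertex w b S = output-withIsolatedVertex (k (cut w S))

  queries-withIsolatedVertex : ∀ A → queries (withIsolatedVertex A) w ≡ queries A (addIsolatedVertex w)
  queries-withIsolatedVertex (done v)          = refl
  queries-withIsolatedVertex (query (b ∷ S) k)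
    rewrite cut-addIsolatedVertex w b S = cong ℕ.suc (queries-withIsolatedVertex (k (cut w S)))

withIsolatedVertex-solvesMaxCut : ∀ {m} {A : Alg (ℕ.suc m)} → SolvesMaxCut A → SolvesMaxCut (withIsolatedVertex A)
withIsolatedVertex-solvesMaxCut {A = A} solves w w-graph = begin
  output (withIsolatedVertex A) w      ≡⟨ output-withIsolatedVertex w A ⟩
  output A (addIsolatedVertex w)       ≡⟨ solves _ (addIsolatedVertex-isWeightedGraph w-graph) ⟩
  maxCut (addIsolatedVertex w)         ≡⟨ maxCut-addIsolatedVertex w ⟩
  maxCut w                             ∎
  where open ≡-Reasoning

-- Homogeneous linear systems with more unknowns than equations

data PivotSplit {N} : List (Fin (ℕ.suc N) → ℚ) → Set where
  no-pivot : ∀ {L} → All (λ a → a zero ≡ 0ℚ) L → PivotSplit L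
  pivot    : ∀ {L} a rest → a zero ≢ 0ℚ → L ↭ a ∷ rest → PivotSplit L

pivotSplit : ∀ {N} (L : List (Fin (ℕ.suc N) → ℚ)) → PivotSplit L
pivotSplit []      = no-pivot []
pivotSplit (a ∷ L) with a zero ≟ 0ℚ
... | no a₀≢0 = pivot a L a₀≢0 ↭-refl
... | yes a₀≡0 with pivotSplit L
...   | no-pivot zeros           = no-pivot (a₀≡0 ∷ zeros)
...   | pivot b rest b₀≢0 L↭b∷rest =
  pivot b (a ∷ rest) b₀≢0 (↭-trans (↭.prep a L↭b∷rest) (↭.swap a b ↭-refl))

eliminate : ∀ {N} → (Fin (ℕ.suc N) → ℚ) → (Fin (ℕ.suc N) → ℚ) → Fin N → ℚ
eliminate a b i = a zero * b (suc i) - b zero * a (suc i)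

backSubstitute : ∀ {N} → (Fin (ℕ.suc N) → ℚ) → (Fin N → ℚ) → Fin (ℕ.suc N) → ℚ
backSubstitute a y zero    = - dot (λ i → a (suc i)) y
backSubstitute a y (suc i) = a zero * y i

dot-backSubstitute : ∀ {N} (a b : Fin (ℕ.suc N) → ℚ) y →
                     dot b (backSubstitute a y) ≡ dot (eliminate a b) y
dot-backSubstitute {N} a b y = begin
  b zero * - T + sumFin N (λ i → b (suc i) * (a zero * y i))
    ≡⟨ reorder (b zero) T _ ⟩
  sumFin N (λ i → b (suc i) * (a zero * y i)) + - b zero * T
    ≡⟨ sym (sumFin-linear N _ _ (- b zero)) ⟩
  sumFin N (λ i → b (suc i) * (a zero * y i) + - b zero * (a (suc i) * y i))
    ≡⟨ sumFin-cong N (λ i → expand (a zero) (b (suc i)) (b zero) (a (suc i)) (y i)) ⟩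
  dot (eliminate a b) y ∎
  where
  open ≡-Reasoning
  T = dot (λ i → a (suc i)) y
  reorder : ∀ b₀ t s → b₀ * - t + s ≡ s + - b₀ * t
  reorder = solve-∀ ℚ-ring
  expand : ∀ a₀ bᵢ b₀ aᵢ yᵢ → bᵢ * (a₀ * yᵢ) + - b₀ * (aᵢ * yᵢ) ≡ (a₀ * bᵢ - b₀ * aᵢ) * yᵢ
  expand = solve-∀ ℚ-ring

dot-eliminate-self : ∀ {N} (a : Fin (ℕ.suc N) → ℚ) y → dot (eliminate a a) y ≡ 0ℚ
dot-eliminate-self {N} a y = trans (sumFin-cong N (λ i → cancel (a zero) (a (suc i)) (y i))) (sumFin-zero N)
  where
  cancel : ∀ a₀ aᵢ yᵢ → (a₀ * aᵢ - a₀ * aᵢ) * yᵢ ≡ 0ℚ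
  cancel = solve-∀ ℚ-ring

dot-δ : ∀ {N} (a : Fin N → ℚ) l → dot a (δ l) ≡ a l
dot-δ {N} a l = trans (sumFin-cong N (λ i → *-comm (a i) (δ l i))) (sumFin-δ N l a)

nonzero-solution : ∀ N (L : List (Fin N → ℚ)) → length L ℕ.< N →
                   ∃ λ x → (∃ λ l → x l ≢ 0ℚ) × All (λ a → dot a x ≡ 0ℚ) L
nonzero-solution (ℕ.suc N) L |L|<N with pivotSplit L
... | no-pivot zeros = δ zero , (zero , 1≢0) , All.map (λ {a} a₀≡0 → trans (dot-δ a zero) a₀≡0) zeros
... | pivot a rest a₀≢0 L↭a∷rest
  with nonzero-solution N (map (eliminate a) rest) |rest|<N
  where
  |rest|<N : length (map (eliminate a) rest) ℕ.< N
  |rest|<N = subst (ℕ._< N) (sym (length-map (eliminate a) rest))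
                   (ℕ.≤-pred (subst (ℕ._< ℕ.suc N) (↭-length L↭a∷rest) |L|<N))
...   | y , (l , yₗ≢0) , orthogonal =
  backSubstitute a y ,
  (suc l , λ a₀yₗ≡0 → yₗ≢0 (p*q≡0⇒q≡0 a₀≢0 a₀yₗ≡0)) ,
  All-resp-↭ (↭-sym L↭a∷rest)
    (trans (dot-backSubstitute a a y) (dot-eliminate-self a y) ∷
     All.map (λ {b} eq → trans (dot-backSubstitute a b y) eq) (All.map⁻ orthogonal))

edges : ℕ → ℕ
edges ℕ.zero    = 0
edges (ℕ.suc m) = m ℕ.+ edges m

edges≡mC2 : ∀ m → edges m ≡ m C 2
edges≡mC2 ℕ.zero    = refl
edges≡mC2 (ℕ.suc m) = begin
  m ℕ.+ edges m    ≡⟨ cong₂ ℕ._+_ (sym (nC1≡n m)) (edges≡mC2 m) ⟩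
  m C 1 ℕ.+ m C 2  ≡⟨ nCk+nC[k+1]≡[n+1]C[k+1] m 1 ⟩
  ℕ.suc m C 2      ∎
  where open ≡-Reasoning

-- Vertex zero is joined to suc j by the edge j ↑ˡ edges m, the rest is a graph on the other vertices.
graphOf : ∀ {m} → (Fin (edges m) → ℚ) → Weights m
graphOf {ℕ.suc m} x zero    zero    = 0ℚ
graphOf {ℕ.suc m} x zero    (suc j) = x (j ↑ˡ edges m)
graphOf {ℕ.suc m} x (suc i) zero    = x (i ↑ˡ edges m)
graphOf {ℕ.suc m} x (suc i) (suc j) = graphOf {m} (λ e → x (m ↑ʳ e)) i j

graphOf-sym : ∀ {m} (x : Fin (edges m) → ℚ) (i j : Fin m) → graphOf x i j ≡ graphOf x j i
graphOf-sym {ℕ.suc m} x zero    zero    = refl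
graphOf-sym {ℕ.suc m} x zero    (suc j) = refl
graphOf-sym {ℕ.suc m} x (suc i) zero    = refl
graphOf-sym {ℕ.suc m} x (suc i) (suc j) = graphOf-sym {m} (λ e → x (m ↑ʳ e)) i j

graphOf-diagonal : ∀ {m} (x : Fin (edges m) → ℚ) (i : Fin m) → graphOf x i i ≡ 0ℚ
graphOf-diagonal {ℕ.suc m} x zero    = refl
graphOf-diagonal {ℕ.suc m} x (suc i) = graphOf-diagonal {m} (λ e → x (m ↑ʳ e)) i

graphOf≡0⇒≡0 : ∀ {m} (x : Fin (edges m) → ℚ) → (∀ (i j : Fin m) → graphOf x i j ≡ 0ℚ) → ∀ e → x e ≡ 0ℚ
graphOf≡0⇒≡0 {ℕ.suc m} x graph≡0 e with splitAt m e in split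
... | inj₁ j  = trans (cong x (sym (splitAt⁻¹-↑ˡ split))) (graph≡0 zero (suc j))
... | inj₂ e′ = trans (cong x (sym (splitAt⁻¹-↑ʳ split)))
                      (graphOf≡0⇒≡0 {m} (λ e → x (m ↑ʳ e)) (λ i j → graph≡0 (suc i) (suc j)) e′)

edgeCoefficients : ∀ {m} → (Fin m → Fin m → ℚ) → Fin (edges m) → ℚ
edgeCoefficients {ℕ.suc m} A e =
  [ (λ j → A zero (suc j) + A (suc j) zero) , edgeCoefficients (λ i j → A (suc i) (suc j)) ]′ (splitAt m e)

inner-graphOf : ∀ {m} (A : Fin m → Fin m → ℚ) x → inner A (graphOf x) ≡ dot (edgeCoefficients A) x
inner-graphOf {ℕ.zero}  A x = refl
inner-graphOf {ℕ.suc m} A x = begin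
  inner A (graphOf x)
    ≡⟨⟩
  (A zero zero * 0ℚ + row) + sumFin m (λ i → A (suc i) zero * xˡ i + dot (A′ i) (graphOf {m} x′ i))
    ≡⟨ cong₂ _+_ (trans (cong (_+ row) (*-zeroʳ (A zero zero))) (+-identityˡ row))
                 (sumFin-+ m (λ i → A (suc i) zero * xˡ i) (λ i → dot (A′ i) (graphOf {m} x′ i))) ⟩
  row + (column + inner A′ (graphOf {m} x′))
    ≡⟨ sym (+-assoc row column _) ⟩
  row + column + inner A′ (graphOf {m} x′)
    ≡⟨ cong₂ _+_ (sym (sumFin-+ m (λ j → A zero (suc j) * xˡ j) (λ j → A (suc j) zero * xˡ j)))
                 (inner-graphOf {m} A′ x′) ⟩
  sumFin m (λ j → A zero (suc j) * xˡ j + A (suc j) zero * xˡ j) + dot (edgeCoefficients A′) x′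
    ≡⟨ cong₂ _+_ (sumFin-cong m (λ j → trans (sym (*-distribʳ-+ (xˡ j) (A zero (suc j)) (A (suc j) zero)))
                                             (cong (_* xˡ j) (sym (coefficient-↑ˡ j)))))
                 (sumFin-cong (edges m) (λ e → cong (_* x′ e) (sym (coefficient-↑ʳ e)))) ⟩
  sumFin m (λ j → c (j ↑ˡ edges m) * xˡ j) + sumFin (edges m) (λ e → c (m ↑ʳ e) * x′ e)
    ≡⟨ sym (sumFin-++ m (edges m) (λ e → c e * x e)) ⟩
  dot c x ∎
  where
  open ≡-Reasoning
  c = edgeCoefficients A
  A′ = λ i j → A (suc i) (suc j)
  xˡ = λ j → x (j ↑ˡ edges m)
  x′ : Fin (edges m) → ℚ
  x′ e = x (m ↑ʳ e)
  row = sumFin m (λ j → A zero (suc j) * xˡ j)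
  column = sumFin m (λ i → A (suc i) zero * xˡ i)
  coefficient-↑ˡ : ∀ j → c (j ↑ˡ edges m) ≡ A zero (suc j) + A (suc j) zero
  coefficient-↑ˡ j = cong [ _ , _ ]′ (splitAt-↑ˡ m j (edges m))
  coefficient-↑ʳ : ∀ e → c (m ↑ʳ e) ≡ edgeCoefficients A′ e
  coefficient-↑ʳ e = cong [ _ , _ ]′ (splitAt-↑ʳ m (edges m) e)

-- Perturbations invisible to the algorithm

perturb : ∀ {n} → Weights n → ℚ → Weights n → Weights n
perturb w t d i j = w i j + t * d i j

cut-perturb : ∀ {n} (w : Weights n) t d S → cut (perturb w t d) S ≡ cut w S + t * inner (crossing S) d
cut-perturb w t d S = begin
  cut (perturb w t d) S                          ≡⟨ cut≡inner (perturb w t d) S ⟩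
  inner (crossing S) (perturb w t d)             ≡⟨ inner-linear (crossing S) w d t ⟩
  inner (crossing S) w + t * inner (crossing S) d ≡⟨ cong (_+ _) (sym (cut≡inner w S)) ⟩
  cut w S + t * inner (crossing S) d             ∎
  where open ≡-Reasoning

small-scale : ∀ {n} (d : Weights n) →
              ∃ λ s → 0ℚ < s × (∀ t → abs t ≡ s → ∀ i j → abs (t * d i j) ≤ 1ℚ)
small-scale {n} d = 1/ c , positive⁻¹ (1/ c) {{1/pos⇒pos c}} , bound
  where
  total = sumFin n (λ i → sumFin n (λ j → abs (d i j)))
  0≤total : 0ℚ ≤ total
  0≤total = sumFin-nonNeg n _ (λ i → sumFin-nonNeg n _ (λ j → 0≤∣p∣ (d i j)))
  c = 1ℚ + total
  0<c : 0ℚ < c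
  0<c = subst (_< c) (+-identityˡ 0ℚ) (+-mono-<-≤ (positive⁻¹ 1ℚ) 0≤total)
  instance
    c-positive : Positive c
    c-positive = positive 0<c
    c-nonZero : NonZero c
    c-nonZero = pos⇒nonZero c
    1/c-nonNegative : NonNegative (1/ c)
    1/c-nonNegative = nonNegative (<⇒≤ (positive⁻¹ (1/ c) {{1/pos⇒pos c}}))
  entry≤c : ∀ i j → abs (d i j) ≤ c
  entry≤c i j = ≤-trans (term≤sumFin n _ (λ j → 0≤∣p∣ (d i j)) j)
                (≤-trans (term≤sumFin n _ (λ i → sumFin-nonNeg n _ (λ j → 0≤∣p∣ (d i j))) i)
                         (subst (_≤ c) (+-identityˡ total) (+-monoˡ-≤ total (nonNegative⁻¹ 1ℚ))))
  bound : ∀ t → abs t ≡ 1/ c → ∀ i j → abs (t * d i j) ≤ 1ℚ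
  bound t |t|≡1/c i j = begin
    abs (t * d i j)        ≡⟨ ∣p*q∣≡∣p∣*∣q∣ t (d i j) ⟩
    abs t * abs (d i j)    ≡⟨ cong (_* abs (d i j)) |t|≡1/c ⟩
    1/ c * abs (d i j)     ≤⟨ *-monoˡ-≤-nonNeg (1/ c) (entry≤c i j) ⟩
    1/ c * c               ≡⟨ *-inverseˡ c ⟩
    1ℚ                     ∎
    where open ≤-Reasoning

perturb-isWeightedGraph : ∀ {n} {w d : Weights n} → IsWeightedGraph w →
                          (∀ i j → w i j ≡ 0ℚ ⊎ w i j ≡ 1ℚ) → (∀ i j → w i j ≡ 0ℚ → d i j ≡ 0ℚ) →
                          (∀ i j → d i j ≡ d j i) →
                          ∀ t → (∀ i j → abs (t * d i j) ≤ 1ℚ) → IsWeightedGraph (perturb w t d)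
perturb-isWeightedGraph {w = w} {d} (w-sym , _) w∈01 d-supported d-sym t small =
  (λ i j → cong₂ (λ x y → x + t * y) (w-sym i j) (d-sym i j)) , nonNeg
  where
  0≤1+p : ∀ p → abs p ≤ 1ℚ → 0ℚ ≤ 1ℚ + p
  0≤1+p p |p|≤1 with ∣p∣≡p∨∣p∣≡-p p
  ... | inj₁ |p|≡p  = +-mono-≤ (nonNegative⁻¹ 1ℚ) (subst (0ℚ ≤_) |p|≡p (0≤∣p∣ p))
  ... | inj₂ |p|≡-p = subst (_≤ 1ℚ + p) (+-inverseˡ p) (+-monoˡ-≤ p (subst (_≤ 1ℚ) |p|≡-p |p|≤1))
  nonNeg : ∀ i j → 0ℚ ≤ perturb w t d i j
  nonNeg i j with w∈01 i j
  ... | inj₁ wᵢⱼ≡0 = ≤-reflexive (sym (trans (cong₂ (λ x y → x + t * y) wᵢⱼ≡0 (d-supported i j wᵢⱼ≡0))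
                                             (zero-sum t)))
    where
    zero-sum : ∀ t → 0ℚ + t * 0ℚ ≡ 0ℚ
    zero-sum = solve-∀ ℚ-ring
  ... | inj₂ wᵢⱼ≡1 = subst (λ x → 0ℚ ≤ x + t * d i j) (sym wᵢⱼ≡1) (0≤1+p (t * d i j) (small i j))

module _ {n} {A : Alg n} (solves : SolvesMaxCut A) {w d : Weights n}
         (w-graph : IsWeightedGraph w) (w∈01 : ∀ i j → w i j ≡ 0ℚ ⊎ w i j ≡ 1ℚ)
         (d-supported : ∀ i j → w i j ≡ 0ℚ → d i j ≡ 0ℚ) (d-sym : ∀ i j → d i j ≡ d j i)
         (d-unseen : All (λ S → inner (crossing S) d ≡ 0ℚ) (queriedSets A w)) where

  maxCut-perturb : ∀ t → (∀ i j → abs (t * d i j) ≤ 1ℚ) → maxCut (perturb w t d) ≡ maxCut w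
  maxCut-perturb t small = begin
    maxCut (perturb w t d)   ≡⟨ sym (solves _ (perturb-isWeightedGraph w-graph w∈01 d-supported d-sym t small)) ⟩
    output A (perturb w t d) ≡⟨ output-determined A (All.map unchanged d-unseen) ⟩
    output A w               ≡⟨ solves w w-graph ⟩
    maxCut w                 ∎
    where
    open ≡-Reasoning
    unchanged : ∀ {S} → inner (crossing S) d ≡ 0ℚ → cut (perturb w t d) S ≡ cut w S
    unchanged {S} c≡0 = begin
      cut (perturb w t d) S              ≡⟨ cut-perturb w t d S ⟩
      cut w S + t * inner (crossing S) d ≡⟨ cong (λ c → cut w S + t * c) c≡0 ⟩
      cut w S + t * 0ℚ                   ≡⟨ cong (cut w S +_) (*-zeroʳ t) ⟩
      cut w S + 0ℚ                       ≡⟨ +-identityʳ (cut w S) ⟩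
      cut w S                            ∎

  unseen-direction-flat-on-maxCuts : ∀ S → cut w S ≡ maxCut w → inner (crossing S) d ≡ 0ℚ
  unseen-direction-flat-on-maxCuts S S-max = p*q≡0⇒q≡0 (λ s≡0 → <⇒≢ 0<s (sym s≡0)) (≤-antisym sc≤0 0≤sc)
    where
    s = proj₁ (small-scale d)
    0<s = proj₁ (proj₂ (small-scale d))
    c = inner (crossing S) d
    tc≤0 : ∀ t → abs t ≡ s → t * c ≤ 0ℚ
    tc≤0 t |t|≡s = x+y≤x⇒y≤0 (begin
      cut w S + t * c          ≡⟨ sym (cut-perturb w t d S) ⟩
      cut (perturb w t d) S    ≤⟨ cut≤maxCut (perturb w t d) S ⟩
      maxCut (perturb w t d)   ≡⟨ maxCut-perturb t (proj₂ (proj₂ (small-scale d)) t |t|≡s) ⟩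
      maxCut w                 ≡⟨ sym S-max ⟩
      cut w S                  ∎)
      where open ≤-Reasoning
    |s|≡s : abs s ≡ s
    |s|≡s = 0≤p⇒∣p∣≡p (<⇒≤ 0<s)
    sc≤0 : s * c ≤ 0ℚ
    sc≤0 = tc≤0 s |s|≡s
    0≤sc : 0ℚ ≤ s * c
    0≤sc = subst (0ℚ ≤_) (neg-involutive s c) (neg-antimono-≤ (tc≤0 (- s) (trans (∣-p∣≡∣p∣ s) |s|≡s)))
      where
      neg-involutive : ∀ s c → - (- s * c) ≡ s * c
      neg-involutive = solve-∀ ℚ-ring

δ-refl : ∀ {n} (i : Fin n) → δ i i ≡ 1ℚ
δ-refl zero    = refl
δ-refl (suc i) = δ-refl i

δ-≢ : ∀ {n} {i j : Fin n} → i ≢ j → δ i j ≡ 0ℚ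
δ-≢ {i = zero}  {zero}  i≢j = ⊥-elim (i≢j refl)
δ-≢ {i = zero}  {suc j} i≢j = refl
δ-≢ {i = suc i} {zero}  i≢j = refl
δ-≢ {i = suc i} {suc j} i≢j = δ-≢ (λ i≡j → i≢j (cong suc i≡j))

δ-sym : ∀ {n} (i j : Fin n) → δ i j ≡ δ j i
δ-sym zero    zero    = refl
δ-sym zero    (suc j) = refl
δ-sym (suc i) zero    = refl
δ-sym (suc i) (suc j) = δ-sym i j

complete : ∀ {m} → Weights m
complete i j = 1ℚ - δ i j

complete∈01 : ∀ {m} (i j : Fin m) → complete i j ≡ 0ℚ ⊎ complete i j ≡ 1ℚ
complete∈01 i j with i Fin.≟ j
... | yes refl = inj₁ (trans (cong (λ x → 1ℚ - x) (δ-refl i)) (+-inverseʳ 1ℚ))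
... | no  i≢j  = inj₂ (cong (λ x → 1ℚ - x) (δ-≢ i≢j))

complete≡0⇒≡ : ∀ {m} {i j : Fin m} → complete i j ≡ 0ℚ → i ≡ j
complete≡0⇒≡ {i = i} {j} eq with i Fin.≟ j
... | yes i≡j = i≡j
... | no  i≢j = ⊥-elim (1≢0 (trans (sym (cong (λ x → 1ℚ - x) (δ-≢ i≢j))) eq))

complete-isWeightedGraph : ∀ {m} → IsWeightedGraph (complete {m})
complete-isWeightedGraph = (λ i j → cong (λ x → 1ℚ - x) (δ-sym i j)) , nonNeg
  where
  nonNeg : ∀ i j → 0ℚ ≤ complete i j
  nonNeg i j with complete∈01 i j
  ... | inj₁ eq = ≤-reflexive (sym eq)
  ... | inj₂ eq = subst (0ℚ ≤_) (sym eq) (nonNegative⁻¹ 1ℚ)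

sumFin-1-χ : ∀ {n} (S : Subset n) → sumFin n (λ j → 1ℚ - χ S j) ≡ fromℕ ∣ ∁ S ∣
sumFin-1-χ []          = refl
sumFin-1-χ (true  ∷ S) = trans (cong (1ℚ - 1ℚ +_) (sumFin-1-χ S)) (cancel (fromℕ ∣ ∁ S ∣))
  where
  cancel : ∀ x → 1ℚ - 1ℚ + x ≡ x
  cancel = solve-∀ ℚ-ring
sumFin-1-χ (false ∷ S) = cong (1ℚ - 0ℚ +_) (sumFin-1-χ S)

cut-complete : ∀ {m} (S : Subset m) → cut complete S ≡ fromℕ (∣ S ∣ ℕ.* ∣ ∁ S ∣)
cut-complete {m} S = begin
  cut complete S
    ≡⟨ cut≡inner complete S ⟩
  sumFin m (λ i → sumFin m (λ j → crossing S i j * (1ℚ - δ i j)))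
    ≡⟨ sumFin-cong m (λ i → begin
         sumFin m (λ j → crossing S i j * (1ℚ - δ i j))
           ≡⟨ sumFin-cong m (λ j → split (crossing S i j) (δ i j)) ⟩
         sumFin m (λ j → crossing S i j + - 1ℚ * (δ i j * crossing S i j))
           ≡⟨ sumFin-linear m _ _ (- 1ℚ) ⟩
         sumFin m (λ j → χ S i * (1ℚ - χ S j)) + - 1ℚ * sumFin m (λ j → δ i j * crossing S i j)
           ≡⟨ cong₂ (λ x y → x + - 1ℚ * y) (sumFin-*ˡ m (χ S i) _) (sumFin-δ m i (crossing S i)) ⟩
         χ S i * sumFin m (λ j → 1ℚ - χ S j) + - 1ℚ * (χ S i * (1ℚ - χ S i))
           ≡⟨ cong₂ (λ x y → χ S i * x + - 1ℚ * y) (sumFin-1-χ S) (χ*[1-χ]≡0 S i) ⟩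
         χ S i * fromℕ ∣ ∁ S ∣ + - 1ℚ * 0ℚ
           ≡⟨ drop-zero (χ S i * fromℕ ∣ ∁ S ∣) ⟩
         χ S i * fromℕ ∣ ∁ S ∣ ∎) ⟩
  sumFin m (λ i → χ S i * fromℕ ∣ ∁ S ∣)
    ≡⟨ sumFin-cong m (λ i → *-comm (χ S i) (fromℕ ∣ ∁ S ∣)) ⟩
  sumFin m (λ i → fromℕ ∣ ∁ S ∣ * χ S i)
    ≡⟨ sumFin-*ˡ m (fromℕ ∣ ∁ S ∣) (χ S) ⟩
  fromℕ ∣ ∁ S ∣ * sumFin m (χ S)
    ≡⟨ cong (fromℕ ∣ ∁ S ∣ *_) (sumFin-χ S) ⟩
  fromℕ ∣ ∁ S ∣ * fromℕ ∣ S ∣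
    ≡⟨ *-comm (fromℕ ∣ ∁ S ∣) (fromℕ ∣ S ∣) ⟩
  fromℕ ∣ S ∣ * fromℕ ∣ ∁ S ∣
    ≡⟨ sym (fromℕ-* ∣ S ∣ ∣ ∁ S ∣) ⟩
  fromℕ (∣ S ∣ ℕ.* ∣ ∁ S ∣) ∎
  where
  open ≡-Reasoning
  split : ∀ c e → c * (1ℚ - e) ≡ c + - 1ℚ * (e * c)
  split = solve-∀ ℚ-ring
  drop-zero : ∀ x → x + - 1ℚ * 0ℚ ≡ x
  drop-zero = solve-∀ ℚ-ring

∣S∣+∣∁S∣≡n : ∀ {n} (S : Subset n) → ∣ S ∣ ℕ.+ ∣ ∁ S ∣ ≡ n
∣S∣+∣∁S∣≡n S = trans (cong (∣ S ∣ ℕ.+_) (∣∁p∣≡n∸∣p∣ S)) (ℕ.m+[n∸m]≡n (∣p∣≤n S))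

-- A part of size s ≤ k of a set of size 2k+1 gives the product s (2k+1-s) = k(k+1) - (k-s)(k-s+1).
product-bound-≤ : ∀ {s r k} → s ℕ.≤ k → s ℕ.+ r ≡ ℕ.suc (k ℕ.+ k) → s ℕ.* r ℕ.≤ k ℕ.* ℕ.suc k
product-bound-≤ {s} {r} s≤k s+r≡2k+1 with ℕ.m≤n⇒∃[o]m+o≡n s≤k
... | a , refl = begin
  s ℕ.* r                                                ≡⟨ cong (s ℕ.*_) r≡ ⟩
  s ℕ.* ℕ.suc (a ℕ.+ (s ℕ.+ a))                           ≤⟨ ℕ.m≤m+n _ _ ⟩
  s ℕ.* ℕ.suc (a ℕ.+ (s ℕ.+ a)) ℕ.+ a ℕ.* ℕ.suc a         ≡⟨ expand s a ⟩
  (s ℕ.+ a) ℕ.* ℕ.suc (s ℕ.+ a)                           ∎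
  where
  open ℕ.≤-Reasoning
  rearrange : ∀ s a → ℕ.suc ((s ℕ.+ a) ℕ.+ (s ℕ.+ a)) ≡ s ℕ.+ ℕ.suc (a ℕ.+ (s ℕ.+ a))
  rearrange = ℕ-solve
  expand : ∀ s a → s ℕ.* ℕ.suc (a ℕ.+ (s ℕ.+ a)) ℕ.+ a ℕ.* ℕ.suc a ≡ (s ℕ.+ a) ℕ.* ℕ.suc (s ℕ.+ a)
  expand = ℕ-solve
  r≡ : r ≡ ℕ.suc (a ℕ.+ (s ℕ.+ a))
  r≡ = ℕ.+-cancelˡ-≡ s r _ (trans s+r≡2k+1 (rearrange s a))

product-bound : ∀ s r k → s ℕ.+ r ≡ ℕ.suc (k ℕ.+ k) → s ℕ.* r ℕ.≤ k ℕ.* ℕ.suc k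
product-bound s r k s+r≡2k+1 with s ℕ.≤? k
... | yes s≤k = product-bound-≤ s≤k s+r≡2k+1
... | no  s≰k =
  subst (ℕ._≤ k ℕ.* ℕ.suc k) (ℕ.*-comm r s) (product-bound-≤ r≤k (trans (ℕ.+-comm r s) s+r≡2k+1))
  where
  r≤k : r ℕ.≤ k
  r≤k = ℕ.+-cancelˡ-≤ (ℕ.suc k) r k
          (subst (ℕ.suc k ℕ.+ r ℕ.≤_) s+r≡2k+1 (ℕ.+-monoˡ-≤ r (ℕ.≰⇒> s≰k)))

Balanced : ∀ {m} → ℕ → Subset m → Set
Balanced k S = ∣ S ∣ ≡ k ⊎ ∣ S ∣ ≡ ℕ.suc k

cut-complete-balanced : ∀ k (S : Subset (ℕ.suc (k ℕ.+ k))) → Balanced k S →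
                        cut complete S ≡ fromℕ (k ℕ.* ℕ.suc k)
cut-complete-balanced k S balanced = trans (cut-complete S) (cong fromℕ (balanced-product balanced))
  where
  ∣∁S∣≡ : ∀ {s c} → ∣ S ∣ ≡ s → s ℕ.+ c ≡ ℕ.suc (k ℕ.+ k) → ∣ ∁ S ∣ ≡ c
  ∣∁S∣≡ {s} ∣S∣≡s s+c≡m =
    ℕ.+-cancelˡ-≡ s _ _ (trans (subst (λ x → x ℕ.+ ∣ ∁ S ∣ ≡ _) ∣S∣≡s (∣S∣+∣∁S∣≡n S)) (sym s+c≡m))
  balanced-product : Balanced k S → ∣ S ∣ ℕ.* ∣ ∁ S ∣ ≡ k ℕ.* ℕ.suc k
  balanced-product (inj₁ ∣S∣≡k)  = cong₂ ℕ._*_ ∣S∣≡k (∣∁S∣≡ ∣S∣≡k (ℕ.+-suc k k))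
  balanced-product (inj₂ ∣S∣≡k+1) =
    trans (cong₂ ℕ._*_ ∣S∣≡k+1 (∣∁S∣≡ ∣S∣≡k+1 refl)) (ℕ.*-comm (ℕ.suc k) k)

balanced-isMaxCut : ∀ k (S : Subset (ℕ.suc (k ℕ.+ k))) → Balanced k S →
                    cut complete S ≡ maxCut (complete {ℕ.suc (k ℕ.+ k)})
balanced-isMaxCut k S balanced =
  maximum-cut complete S (cut-complete-balanced k S balanced)
    (λ T → subst (_≤ fromℕ (k ℕ.* ℕ.suc k)) (sym (cut-complete T))
                 (fromℕ-mono-≤ (product-bound ∣ T ∣ ∣ ∁ T ∣ k (∣S∣+∣∁S∣≡n T))))
    (0≤fromℕ (k ℕ.* ℕ.suc k))

-- Balanced cuts determine the edge weights

insert : ∀ {m} → Fin m → Subset m → Subset m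
insert a X = X [ a ]≔ inside

∣insert∣ : ∀ {m} (X : Subset m) {a} → lookup X a ≡ outside → ∣ insert a X ∣ ≡ ℕ.suc ∣ X ∣
∣insert∣ (false ∷ X) {zero}  _   = refl
∣insert∣ (true  ∷ X) {suc a} a∉X = cong ℕ.suc (∣insert∣ X a∉X)
∣insert∣ (false ∷ X) {suc a} a∉X = ∣insert∣ X a∉X

∣insert∣≤ : ∀ {m} (X : Subset m) a → ∣ insert a X ∣ ℕ.≤ ℕ.suc ∣ X ∣
∣insert∣≤ (true  ∷ X) zero    = ℕ.n≤1+n _
∣insert∣≤ (false ∷ X) zero    = ℕ.≤-refl
∣insert∣≤ (true  ∷ X) (suc a) = ℕ.s≤s (∣insert∣≤ X a)
∣insert∣≤ (false ∷ X) (suc a) = ∣insert∣≤ X a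

χ-insert : ∀ {m} (X : Subset m) {a} → lookup X a ≡ outside → ∀ i → χ (insert a X) i ≡ χ X i + δ a i
χ-insert (false ∷ X) {zero}  _   zero    = refl
χ-insert (false ∷ X) {zero}  _   (suc i) = sym (+-identityʳ _)
χ-insert (b     ∷ X) {suc a} _   zero    = sym (+-identityʳ _)
χ-insert (b     ∷ X) {suc a} a∉X (suc i) = χ-insert X a∉X i

insert-keeps : ∀ {m} (X : Subset m) a {i} → lookup X i ≡ inside → lookup (insert a X) i ≡ inside
insert-keeps X a {i} i∈X with i Fin.≟ a
... | yes refl = lookup∘updateAt i X
... | no  i≢a  = trans (lookup∘updateAt′ i a i≢a X) i∈X

insert-other : ∀ {m} (X : Subset m) {a b} → b ≢ a → lookup (insert a X) b ≡ lookup X b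
insert-other X {a} {b} b≢a = lookup∘updateAt′ b a b≢a X

cut-secondDifference : ∀ {m} (d : Weights m) X {a b} → lookup X a ≡ outside → lookup X b ≡ outside → a ≢ b →
  let C = λ S → inner (crossing S) d in
  C (insert a X) + C (insert b X) ≡ C (insert b (insert a X)) + C X + (d a b + d b a)
cut-secondDifference {m} d X {a} {b} a∉X b∉X a≢b = begin
  C Xa + C Xb                                  ≡⟨ sym (inner-+ˡ (crossing Xa) (crossing Xb) d) ⟩
  inner (λ i j → crossing Xa i j + crossing Xb i j) d
    ≡⟨ inner-congˡ d pointwise ⟩
  inner (λ i j → (crossing Xab i j + crossing X i j) + (δ a i * δ b j + δ b i * δ a j)) d
    ≡⟨ inner-+ˡ (λ i j → crossing Xab i j + crossing X i j) (λ i j → δ a i * δ b j + δ b i * δ a j) d ⟩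
  inner (λ i j → crossing Xab i j + crossing X i j) d + inner (λ i j → δ a i * δ b j + δ b i * δ a j) d
    ≡⟨ cong₂ _+_ (inner-+ˡ (crossing Xab) (crossing X) d)
                 (trans (inner-+ˡ (λ i j → δ a i * δ b j) (λ i j → δ b i * δ a j) d)
                        (cong₂ _+_ (inner-δδ a b d) (inner-δδ b a d))) ⟩
  C Xab + C X + (d a b + d b a) ∎
  where
  open ≡-Reasoning
  C = λ S → inner (crossing S) d
  Xa = insert a X
  Xb = insert b X
  Xab = insert b Xa
  χ-Xab : ∀ i → χ Xab i ≡ χ X i + δ a i + δ b i
  χ-Xab i = trans (χ-insert Xa (trans (insert-other X (λ b≡a → a≢b (sym b≡a))) b∉X) i)
                  (cong (_+ δ b i) (χ-insert X a∉X i))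
  identity : ∀ u v α α′ β β′ → (u + α) * (1ℚ - (v + α′)) + (u + β) * (1ℚ - (v + β′))
                               ≡ ((u + α + β) * (1ℚ - (v + α′ + β′)) + u * (1ℚ - v)) + (α * β′ + β * α′)
  identity = solve-∀ ℚ-ring
  pointwise : ∀ i j → crossing Xa i j + crossing Xb i j
                      ≡ (crossing Xab i j + crossing X i j) + (δ a i * δ b j + δ b i * δ a j)
  pointwise i j
    rewrite χ-insert X a∉X i | χ-insert X a∉X j | χ-insert X b∉X i | χ-insert X b∉X j | χ-Xab i | χ-Xab j
    = identity (χ X i) (χ X j) (δ a i) (δ a j) (δ b i) (δ b j)

avoiding-subset : ∀ {m} (B : Subset m) s → ∣ B ∣ ℕ.+ s ℕ.≤ m →
                  ∃ λ X → ∣ X ∣ ≡ s × (∀ i → lookup B i ≡ inside → lookup X i ≡ outside)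
avoiding-subset {m} B ℕ.zero _ = ∅ , ∣⊥∣≡0 m , λ i _ → lookup-replicate i outside
avoiding-subset (true ∷ B) (ℕ.suc s) (ℕ.s≤s fits) with avoiding-subset B (ℕ.suc s) fits
... | X , ∣X∣≡s , disjoint = false ∷ X , ∣X∣≡s , λ { zero _ → refl ; (suc i) i∈B → disjoint i i∈B }
avoiding-subset {ℕ.suc m} (false ∷ B) (ℕ.suc s) fits
  with avoiding-subset B s (ℕ.≤-pred (subst (ℕ._≤ ℕ.suc m) (ℕ.+-suc ∣ B ∣ s) fits))
... | X , ∣X∣≡s , disjoint = true ∷ X , cong ℕ.suc ∣X∣≡s , λ { zero () ; (suc i) i∈B → disjoint i i∈B }

small-subset-fits : ∀ k (B : Subset (ℕ.suc (ℕ.suc k ℕ.+ ℕ.suc k))) → ∣ B ∣ ℕ.≤ 4 →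
                    ∣ B ∣ ℕ.+ k ℕ.≤ ℕ.suc (ℕ.suc k ℕ.+ ℕ.suc k)
small-subset-fits ℕ.zero    B _     = subst (ℕ._≤ 3) (sym (ℕ.+-identityʳ ∣ B ∣)) (∣p∣≤n B)
small-subset-fits (ℕ.suc k) B ∣B∣≤4 = ℕ.≤-trans (ℕ.+-monoˡ-≤ (ℕ.suc k) ∣B∣≤4)
                                                (subst (4 ℕ.+ ℕ.suc k ℕ.≤_) (rearrange k) (ℕ.m≤m+n _ k))
  where
  rearrange : ∀ k → (4 ℕ.+ ℕ.suc k) ℕ.+ k ≡ ℕ.suc (ℕ.suc (ℕ.suc k) ℕ.+ ℕ.suc (ℕ.suc k))
  rearrange = ℕ-solve

x+[y+y]≡x+[z+z]⇒y≡z : ∀ {x y z} → x + (y + y) ≡ x + (z + z) → y ≡ z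
x+[y+y]≡x+[z+z]⇒y≡z {x} {y} {z} eq =
  trans (recover x y) (trans (cong (λ w → ½ * (w - x)) eq) (sym (recover x z)))
  where
  recover : ∀ x y → y ≡ ½ * (x + (y + y) - x)
  recover = solve-∀ ℚ-ring

module _ {k} (d : Weights (ℕ.suc (ℕ.suc k ℕ.+ ℕ.suc k))) (d-sym : ∀ i j → d i j ≡ d j i)
         (vanish : ∀ S → Balanced (ℕ.suc k) S → inner (crossing S) d ≡ 0ℚ) where

  private
    m : ℕ
    m = ℕ.suc (ℕ.suc k ℕ.+ ℕ.suc k)
    C : Subset m → ℚ
    C S = inner (crossing S) d

  -- Sizes k + 1 and k + 2 are balanced, so the second difference at a set X of size k only sees the cut of X.
  cut+twice-entry≡0 : ∀ X {a b} → ∣ X ∣ ≡ k → lookup X a ≡ outside → lookup X b ≡ outside → a ≢ b →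
                      C X + (d a b + d a b) ≡ 0ℚ
  cut+twice-entry≡0 X {a} {b} ∣X∣≡k a∉X b∉X a≢b = begin
    C X + (d a b + d a b)                          ≡⟨ cong (λ y → C X + (d a b + y)) (d-sym a b) ⟩
    C X + (d a b + d b a)                          ≡⟨ cong (_+ (d a b + d b a)) (sym (+-identityˡ (C X))) ⟩
    0ℚ + C X + (d a b + d b a)                     ≡⟨ cong (λ c → c + C X + (d a b + d b a))
                                                             (sym (vanish Xab (inj₂ ∣Xab∣))) ⟩
    C Xab + C X + (d a b + d b a)                  ≡⟨ sym (cut-secondDifference d X a∉X b∉X a≢b) ⟩
    C (insert a X) + C (insert b X)                ≡⟨ cong₂ _+_ (vanish (insert a X) (inj₁ (size a∉X)))
                                                                (vanish (insert b X) (inj₁ (size b∉X))) ⟩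
    0ℚ + 0ℚ                                        ≡⟨ +-identityˡ 0ℚ ⟩
    0ℚ                                             ∎
    where
    open ≡-Reasoning
    Xab = insert b (insert a X)
    size : ∀ {c} → lookup X c ≡ outside → ∣ insert c X ∣ ≡ ℕ.suc k
    size c∉X = trans (∣insert∣ X c∉X) (cong ℕ.suc ∣X∣≡k)
    ∣Xab∣ : ∣ Xab ∣ ≡ ℕ.suc (ℕ.suc k)
    ∣Xab∣ = trans (∣insert∣ (insert a X) (trans (insert-other X (λ b≡a → a≢b (sym b≡a))) b∉X))
                  (cong ℕ.suc (size a∉X))

  off-diagonal-constant : ∀ {a b p q} → a ≢ b → p ≢ q → d a b ≡ d p q
  off-diagonal-constant {a} {b} {p} {q} a≢b p≢q =
    x+[y+y]≡x+[z+z]⇒y≡z {C X} (trans (cut+twice-entry≡0 X ∣X∣≡k (outside-X a∈B) (outside-X b∈B) a≢b)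
                               (sym (cut+twice-entry≡0 X ∣X∣≡k (outside-X p∈B) (outside-X q∈B) p≢q)))
    where
    B₁ = insert a ∅
    B₂ = insert b B₁
    B₃ = insert p B₂
    B = insert q B₃
    ∣B∣≤4 : ∣ B ∣ ℕ.≤ 4
    ∣B∣≤4 = begin
      ∣ B ∣            ≤⟨ ∣insert∣≤ B₃ q ⟩
      1 ℕ.+ ∣ B₃ ∣     ≤⟨ ℕ.s≤s (∣insert∣≤ B₂ p) ⟩
      2 ℕ.+ ∣ B₂ ∣     ≤⟨ ℕ.s≤s (ℕ.s≤s (∣insert∣≤ B₁ b)) ⟩
      3 ℕ.+ ∣ B₁ ∣     ≤⟨ ℕ.s≤s (ℕ.s≤s (ℕ.s≤s (∣insert∣≤ ∅ a))) ⟩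
      4 ℕ.+ ∣ ∅ {m} ∣  ≡⟨ cong (4 ℕ.+_) (∣⊥∣≡0 m) ⟩
      4                ∎
      where open ℕ.≤-Reasoning
    a∈B = insert-keeps B₃ q (insert-keeps B₂ p (insert-keeps B₁ b (lookup∘updateAt a ∅)))
    b∈B = insert-keeps B₃ q (insert-keeps B₂ p (lookup∘updateAt b B₁))
    p∈B = insert-keeps B₃ q (lookup∘updateAt p B₂)
    q∈B = lookup∘updateAt q B₃
    avoiding = avoiding-subset B k (small-subset-fits k B ∣B∣≤4)
    X = proj₁ avoiding
    ∣X∣≡k = proj₁ (proj₂ avoiding)
    outside-X : ∀ {i} → lookup B i ≡ inside → lookup X i ≡ outside
    outside-X = proj₂ (proj₂ avoiding) _

balanced-cuts-vanish⇒zero : ∀ k (d : Weights (ℕ.suc (k ℕ.+ k))) →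
                            (∀ i j → d i j ≡ d j i) → (∀ i → d i i ≡ 0ℚ) →
                            (∀ S → Balanced k S → inner (crossing S) d ≡ 0ℚ) → ∀ i j → d i j ≡ 0ℚ
balanced-cuts-vanish⇒zero ℕ.zero    d _     d-diag _      zero zero = d-diag zero
balanced-cuts-vanish⇒zero (ℕ.suc k) d d-sym d-diag vanish i j with i Fin.≟ j
... | yes refl = d-diag i
... | no  i≢j  = p*q≡0⇒q≡0 K[K+1]≢0 (begin
  fromℕ K[K+1] * t                     ≡⟨ *-comm (fromℕ K[K+1]) t ⟩
  t * fromℕ K[K+1]                     ≡⟨ cong (t *_) (sym (cut-complete-balanced (ℕ.suc k) S (inj₁ ∣S∣≡K))) ⟩
  t * cut complete S                   ≡⟨ cong (t *_) (cut≡inner complete S) ⟩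
  t * inner (crossing S) complete      ≡⟨ sym (inner-*ʳ (crossing S) t complete) ⟩
  inner (crossing S) (λ p q → t * complete p q) ≡⟨ sym (inner-cong (crossing S) scaled) ⟩
  inner (crossing S) d                 ≡⟨ vanish S (inj₁ ∣S∣≡K) ⟩
  0ℚ                                   ∎)
  where
  open ≡-Reasoning
  m = ℕ.suc (ℕ.suc k ℕ.+ ℕ.suc k)
  K[K+1] : ℕ
  K[K+1] = ℕ.suc k ℕ.* ℕ.suc (ℕ.suc k)
  K[K+1]≢0 : fromℕ K[K+1] ≢ 0ℚ
  K[K+1]≢0 eq = <⇒≢ (0<fromℕ-suc (ℕ.suc k ℕ.+ k ℕ.* ℕ.suc (ℕ.suc k))) (sym eq)
  t = d i j
  scaled : ∀ p q → d p q ≡ t * complete p q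
  scaled p q with p Fin.≟ q
  ... | yes refl = trans (d-diag p) (sym (trans (cong (λ x → t * (1ℚ - x)) (δ-refl p)) (*-zeroʳ t)))
  ... | no  p≢q  = trans (off-diagonal-constant d d-sym vanish p≢q i≢j)
                         (sym (trans (cong (λ x → t * (1ℚ - x)) (δ-≢ p≢q)) (*-identityʳ t)))
  half = avoiding-subset (∅ {m}) (ℕ.suc k)
           (subst (λ z → z ℕ.+ ℕ.suc k ℕ.≤ m) (sym (∣⊥∣≡0 m)) (ℕ.m≤n+m _ (ℕ.suc (ℕ.suc k))))
  S = proj₁ half
  ∣S∣≡K = proj₁ (proj₂ half)

queries-on-complete≮mC2 : ∀ k (A : Alg (ℕ.suc (k ℕ.+ k))) → SolvesMaxCut A →
                          ¬ queries A complete ℕ.< ℕ.suc (k ℕ.+ k) C 2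
queries-on-complete≮mC2 k A solves few = xₑ≢0 (graphOf≡0⇒≡0 {m} x d≡0 e)
  where
  m = ℕ.suc (k ℕ.+ k)
  constraints = map (λ S → edgeCoefficients (crossing S)) (queriedSets A complete)
  few-constraints : length constraints ℕ.< edges m
  few-constraints = subst₂ ℕ._<_
    (sym (trans (length-map _ (queriedSets A complete)) (length-queriedSets A complete)))
    (sym (edges≡mC2 m)) few
  solution = nonzero-solution (edges m) constraints few-constraints
  x = proj₁ solution
  e = proj₁ (proj₁ (proj₂ solution))
  xₑ≢0 = proj₂ (proj₁ (proj₂ solution))
  d = graphOf {m} x
  unseen : All (λ S → inner (crossing S) d ≡ 0ℚ) (queriedSets A complete)
  unseen = All.map (λ {S} orthogonal → trans (inner-graphOf (crossing S) x) orthogonal)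
                   (All.map⁻ (proj₂ (proj₂ solution)))
  supported : ∀ i j → complete i j ≡ 0ℚ → d i j ≡ 0ℚ
  supported i j kᵢⱼ≡0 = subst (λ j → d i j ≡ 0ℚ) (complete≡0⇒≡ kᵢⱼ≡0) (graphOf-diagonal x i)
  flat : ∀ S → Balanced k S → inner (crossing S) d ≡ 0ℚ
  flat S balanced = unseen-direction-flat-on-maxCuts solves complete-isWeightedGraph complete∈01
                      supported (graphOf-sym x) unseen S (balanced-isMaxCut k S balanced)
  d≡0 = balanced-cuts-vanish⇒zero k d (graphOf-sym x) (graphOf-diagonal x) flat

lowerBound-odd : ∀ {n} k → n ≡ ℕ.suc (k ℕ.+ k) → (A : Alg n) → SolvesMaxCut A →
                 ∃ λ (w : Weights n) → IsWeightedGraph w × n C 2 ℕ.≤ queries A w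
lowerBound-odd k refl A solves =
  complete , complete-isWeightedGraph , ℕ.≮⇒≥ (queries-on-complete≮mC2 k A solves)

lowerBound-even : ∀ {n} k → n ≡ ℕ.suc (ℕ.suc (k ℕ.+ k)) → (A : Alg n) → SolvesMaxCut A →
                  ∃ λ (w : Weights n) → IsWeightedGraph w × (n ℕ.∸ 1) C 2 ℕ.≤ queries A w
lowerBound-even k refl A solves =
  addIsolatedVertex complete ,
  addIsolatedVertex-isWeightedGraph complete-isWeightedGraph ,
  subst (ℕ.suc (k ℕ.+ k) C 2 ℕ.≤_) (queries-withIsolatedVertex complete A)
        (ℕ.≮⇒≥ (queries-on-complete≮mC2 k (withIsolatedVertex A)
                                           (withIsolatedVertex-solvesMaxCut {A = A} solves)))

n≡n%2+[n/2+n/2] : ∀ n → n ≡ n % 2 ℕ.+ (n / 2 ℕ.+ n / 2)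
n≡n%2+[n/2+n/2] n = trans (m≡m%n+[m/n]*n n 2) (cong (n % 2 ℕ.+_) (double (n / 2)))
  where
  double : ∀ h → h ℕ.* 2 ≡ h ℕ.+ h
  double = ℕ-solve

odd⇒2k+1 : ∀ {n} → n % 2 ≡ 1 → ∃ λ k → n ≡ ℕ.suc (k ℕ.+ k)
odd⇒2k+1 {n} n%2≡1 = n / 2 , trans (n≡n%2+[n/2+n/2] n) (cong (ℕ._+ (n / 2 ℕ.+ n / 2)) n%2≡1)

even⇒2k+2 : ∀ {n} → 1 ℕ.≤ n → n % 2 ≡ 0 → ∃ λ k → n ≡ ℕ.suc (ℕ.suc (k ℕ.+ k))
even⇒2k+2 {n} 1≤n n%2≡0 with n / 2 | trans (n≡n%2+[n/2+n/2] n) (cong (ℕ._+ (n / 2 ℕ.+ n / 2)) n%2≡0)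
... | ℕ.zero  | n≡0    = ⊥-elim (ℕ.<⇒≢ 1≤n (sym n≡0))
... | ℕ.suc h | n≡2h+2 = h , subst (λ x → n ≡ ℕ.suc x) (ℕ.+-suc h h) n≡2h+2

theoremA1 : (n : ℕ) → 3 ℕ.≤ n → (A : Alg n)
    → (∀ (w : Weights n) → IsWeightedGraph w → output A w ≡ maxCut w)
    → (n % 2 ≡ 1 → ∃ λ (w : Weights n) → IsWeightedGraph w × n C 2 ℕ.≤ queries A w)
      × (n % 2 ≡ 0 → ∃ λ (w : Weights n) → IsWeightedGraph w × (n ℕ.∸ 1) C 2 ℕ.≤ queries A w)
theoremA1 n 3≤n A solves =
  (λ n%2≡1 → let k , n≡2k+1 = odd⇒2k+1 n%2≡1 in lowerBound-odd k n≡2k+1 A solves) ,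
  (λ n%2≡0 → let k , n≡2k+2 = even⇒2k+2 1≤n n%2≡0 in lowerBound-even k n≡2k+2 A solves)
  where
  1≤n : 1 ℕ.≤ n
  1≤n = ℕ.≤-trans (ℕ.s≤s ℕ.z≤n) 3≤n
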